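{- Fix an integer $N \ge 0$. Let $a_i(n) = \sum_{\ell=0}^{d_i} a_{i\ell} n^\ell \in \mathbf{Z}[n]$ for $i = 1,\dots,k$, and let $m(n) \in \mathbf{Z}[n]$ have positive leading coefficient, with base-$n$ representation $m(n) = \sum_{\ell=0}^{d} b_\ell(n) n^\ell$, where each $b_\ell(n)$ is a polynomial of degree at most one in $n$ with $0 \le b_\ell(n) \le n-1$ for $n \gg 0$, $b_d \neq 0$, and $d \ge \max_{1 \le i \le k} d_i$. For $n \gg 0$ consider \[ S_1(n) = \{(x_1,\dots,x_k) \in \mathbf{Z}^k \mid 0 \le x_i < n^{N+1},\ a_1(n)x_1 + \dots + a_k(n)x_k = m(n)\}. \] Then for $n \gg 0$, $S_1(n)$ is in bijection with a finite union of sets of the form \[ S_2(n) = \{ x = (x_{ij})_{1 \le i \le k,\ 0 \le j \le N} \in \mathbf{Z}^{k(N+1)} \mid 0 \le x_{ij} < n, \text{ and } x \text{ satisfies finitely many constraints each of the form } An + B = f(x) \}, \] where in each constraint $A, B \in \mathbf{Z}$ and $f(x)$ is a linear form in $x$ whose coefficients are constants (independent of $n$); the finitely many sets and their constraints do not depend on $n$. -}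

module Defs where

open import Data.Nat using (ℕ; zero; suc)
open import Data.Integer using (ℤ; +_; _+_; _*_; _^_; _≟_)
open import Data.Fin using (Fin; zero; suc)
open import Data.Vec using (Vec; []; _∷_; zipWith; foldr)
open import Data.List using (List)
open import Data.Bool.ListAction using (any; all)
open import Data.Bool using (Bool)
open import Data.Product using (_×_)
open import Relation.Nullary using (does)

sumFin : (n : ℕ) → (Fin n → ℤ) → ℤ
sumFin zero    f = + 0
sumFin (suc n) f = f zero + sumFin n (λ i → f (suc i))

evalPoly : (deg : ℕ) → (Fin (suc deg) → ℤ) → ℤ → ℤ
evalPoly deg c t = sumFin (suc deg) (λ ℓ → c ℓ * t ^ Data.Fin.toℕ ℓ)

evalLin : ℤ × ℤ → ℤ → ℤ
evalLin (s Data.Product., c) t = s * t + c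

sumV : ∀ {n} → Vec ℤ n → ℤ
sumV = foldr _ _+_ (+ 0)

dot : ∀ {n} → Vec ℤ n → Vec ℤ n → ℤ
dot a x = sumV (zipWith _*_ a x)

linForm : ∀ {k M} → Vec (Vec ℤ M) k → Vec (Vec ℤ M) k → ℤ
linForm f x = sumV (zipWith dot f x)

record Constraint (k N : ℕ) : Set where
  constructor constraint
  field
    A B   : ℤ
    f     : Vec (Vec ℤ (suc N)) k

-- does x satisfy the constraint at parameter n ?  (Boolean, so membership is a proposition)
satisfies : ∀ {k N} → ℤ → Constraint k N → Vec (Vec ℤ (suc N)) k → Bool
satisfies n (constraint A B f) x = does (A * n + B ≟ linForm f x)

-- a constraint system (finite list of constraints) defines one set S₂;
-- a finite list of systems defines the finite union of the corresponding sets.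
inUnion : ∀ {k N} → ℤ → List (List (Constraint k N)) → Vec (Vec ℤ (suc N)) k → Bool
inUnion n systems x = any (λ sys → all (λ c → satisfies n c x) sys) systems

module Submission where

-- Expand each xᵢ in base n, xᵢ = Σⱼ yᵢⱼ nʲ with digits 0 ≤ yᵢⱼ < n.
-- Substituting into  Σᵢ aᵢ(n)xᵢ − m(n)  and collecting powers of n gives a
-- "residual polynomial"  Σ_ℓ e_ℓ(y) n^ℓ  whose coefficients e_ℓ are affine
-- forms in the digits with constant coefficients; hence |e_ℓ(y)| ≤ B·n for a
-- constant B.  For n > B such a sum vanishes iff there are carries c₀ = 0,
-- |c_ℓ| ≤ B+1, ending in 0, with  e_ℓ(y) + c_ℓ = n·c_{ℓ+1}; each of these is a
-- constraint  c_{ℓ+1}·n + (−γ_ℓ − c_ℓ) = f_ℓ(y).  Ranging over all carry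
-- sequences gives the finite union of constraint systems.

open import Defs
open import Data.Nat as ℕ using (ℕ; zero; suc; _≤_; z≤n; s≤s; NonZero; _%_; _/_)
import Data.Nat.Properties as ℕP
open import Data.Nat.DivMod
open import Data.Integer as ℤ
  using (ℤ; +_; -[1+_]; -1ℤ; _+_; _*_; -_; _^_; ∣_∣; +≤+; +<+; _<_)
  renaming (_≤_ to _≤ℤ_; _-_ to _-ℤ_)
import Data.Integer.Properties as ℤP
open import Data.Integer.Tactic.RingSolver using (solve-∀)
open import Algebra.Properties.CommutativeSemigroup ℤP.+-commutativeSemigroup
  using (interchange)
open import Data.Fin using (Fin; zero; suc; toℕ)
open import Data.Vec as V using (Vec; []; _∷_; replicate; zipWith; lookup; tabulate; _[_]≔_)
import Data.Vec.Properties as VP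
open import Data.Vec.Relation.Unary.All as VA using (All; []; _∷_)
import Data.Vec.Relation.Unary.All.Properties as VAP
open import Data.List as L using (List; []; _∷_; concatMap)
import Data.List.Relation.Unary.All as LA
import Data.List.Relation.Unary.All.Properties as LAP
open import Data.List.Relation.Unary.Any as LAny using (Any; here; there)
import Data.List.Relation.Unary.Any.Properties as AnyP
open import Data.List.Membership.Propositional using (_∈_; lose)
open import Data.Bool using (T)
open import Data.Bool.Properties using (T-irrelevant)
open import Data.Product using (Σ; ∃; _×_; _,_; proj₂)
open import Data.Sum using (inj₁; inj₂)
open import Relation.Nullary using (Dec; yes; no; does; Irrelevant)
open import Relation.Binary.PropositionalEquality
open import Function.Bundles using (_⤖_; _⇔_; mk⇔; mk↔ₛ′; Equivalence)
open import Function.Properties.Inverse using (↔⇒⤖)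
open import Axiom.UniquenessOfIdentityProofs using (module Decidable⇒UIP)

open Equivalence using (to; from)

-- 1. Linear forms on digit arrays

-- Σᵢ p fᵢ yᵢ.  Both Defs.dot (p = _*_) and Defs.linForm (p = dot) have
-- this shape, so their linearity and bounds are proved once, here.
pairing : ∀ {A B : Set} {n} → (A → B → ℤ) → Vec A n → Vec B n → ℤ
pairing p f ys = sumV (zipWith p f ys)

size : ∀ {A : Set} {n} → (A → ℕ) → Vec A n → ℕ
size ‖_‖ []       = 0
size ‖_‖ (a ∷ as) = ‖ a ‖ ℕ.+ size ‖_‖ as

module Pairing {A B : Set} (p : A → B → ℤ) where

  pairing-null : ∀ {n} {z : A} → (∀ y → p z y ≡ + 0) →
                 (ys : Vec B n) → pairing p (replicate n z) ys ≡ + 0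
  pairing-null null []       = refl
  pairing-null null (y ∷ ys) = cong₂ _+_ (null y) (pairing-null null ys)

  pairing-additive : ∀ {n} (_⊕_ : A → A → A) → (∀ a b y → p (a ⊕ b) y ≡ p a y + p b y) →
                     (f g : Vec A n) (ys : Vec B n) →
                     pairing p (zipWith _⊕_ f g) ys ≡ pairing p f ys + pairing p g ys
  pairing-additive _⊕_ hom []      []      []       = refl
  pairing-additive _⊕_ hom (a ∷ f) (b ∷ g) (y ∷ ys) =
    trans (cong₂ _+_ (hom a b y) (pairing-additive _⊕_ hom f g ys))
          (interchange (p a y) (p b y) (pairing p f ys) (pairing p g ys))

  pairing-homogeneous : ∀ {n} (c : ℤ) (s : A → A) → (∀ a y → p (s a) y ≡ c * p a y) →
                        (f : Vec A n) (ys : Vec B n) → pairing p (V.map s f) ys ≡ c * pairing p f ys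
  pairing-homogeneous c s hom []      []       = sym (ℤP.*-zeroʳ c)
  pairing-homogeneous c s hom (a ∷ f) (y ∷ ys) =
    trans (cong₂ _+_ (hom a y) (pairing-homogeneous c s hom f ys))
          (sym (ℤP.*-distribˡ-+ c (p a y) (pairing p f ys)))

  pairing-single : ∀ {n} {z : A} → (∀ y → p z y ≡ + 0) →
                   (j : Fin n) (a : A) (ys : Vec B n) →
                   pairing p (replicate n z [ j ]≔ a) ys ≡ p a (lookup ys j)
  pairing-single null zero    a (y ∷ ys) =
    trans (cong (_+_ (p a y)) (pairing-null null ys)) (ℤP.+-identityʳ (p a y))
  pairing-single null (suc j) a (y ∷ ys) =
    trans (cong₂ _+_ (null y) (pairing-single null j a ys)) (ℤP.+-identityˡ _)

  pairing-bound : ∀ {n} (‖_‖ : A → ℕ) (Small : B → Set) (K : ℕ) →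
                  (∀ a y → Small y → ∣ p a y ∣ ≤ ‖ a ‖ ℕ.* K) →
                  (f : Vec A n) (ys : Vec B n) → All Small ys →
                  ∣ pairing p f ys ∣ ≤ size ‖_‖ f ℕ.* K
  pairing-bound ‖_‖ Small K bnd []      []       []       = z≤n
  pairing-bound ‖_‖ Small K bnd (a ∷ f) (y ∷ ys) (s ∷ ss) = begin
    ∣ p a y + pairing p f ys ∣                 ≤⟨ ℤP.∣i+j∣≤∣i∣+∣j∣ (p a y) _ ⟩
    ∣ p a y ∣ ℕ.+ ∣ pairing p f ys ∣           ≤⟨ ℕP.+-mono-≤ (bnd a y s) (pairing-bound ‖_‖ Small K bnd f ys ss) ⟩
    ‖ a ‖ ℕ.* K ℕ.+ size ‖_‖ f ℕ.* K          ≡⟨ ℕP.*-distribʳ-+ K ‖ a ‖ (size ‖_‖ f) ⟨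
    size ‖_‖ (a ∷ f) ℕ.* K                     ∎
    where open ℕP.≤-Reasoning

private
  module DotPairing = Pairing _*_
  module FormPairing {M : ℕ} = Pairing (dot {M})

Form : ℕ → ℕ → Set
Form k M = Vec (Vec ℤ M) k

zeroForm : ∀ {k M} → Form k M
zeroForm {k} {M} = replicate k (replicate M (+ 0))

_⊕_ : ∀ {k M} → Form k M → Form k M → Form k M
_⊕_ = zipWith (zipWith _+_)

_⊛_ : ∀ {k M} → ℤ → Form k M → Form k M
c ⊛ f = V.map (V.map (c *_)) f

coordinate : ∀ {k M} → Fin k → Fin M → Form k M
coordinate i j = zeroForm [ i ]≔ (replicate _ (+ 0) [ j ]≔ + 1)

dot-zero : ∀ {M} (v : Vec ℤ M) → dot (replicate M (+ 0)) v ≡ + 0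
dot-zero {M} = DotPairing.pairing-null {M} {+ 0} ℤP.*-zeroˡ

linForm-zero : ∀ {k M} (y : Form k M) → linForm zeroForm y ≡ + 0
linForm-zero {k} {M} = FormPairing.pairing-null {M} {k} {replicate M (+ 0)} (dot-zero {M})

linForm-⊕ : ∀ {k M} (f g y : Form k M) → linForm (f ⊕ g) y ≡ linForm f y + linForm g y
linForm-⊕ {k} {M} = FormPairing.pairing-additive {M} {k} (zipWith _+_)
  (DotPairing.pairing-additive {M} _+_ (λ a b y → ℤP.*-distribʳ-+ y a b))

linForm-⊛ : ∀ {k M} (c : ℤ) (f y : Form k M) → linForm (c ⊛ f) y ≡ c * linForm f y
linForm-⊛ {k} {M} c = FormPairing.pairing-homogeneous {M} {k} c (V.map (c *_))
  (DotPairing.pairing-homogeneous {M} c (c *_) (λ a y → ℤP.*-assoc c a y))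

linForm-coordinate : ∀ {k M} (i : Fin k) (j : Fin M) (y : Form k M) →
                     linForm (coordinate i j) y ≡ lookup (lookup y i) j
linForm-coordinate {k} {M} i j y =
  trans (FormPairing.pairing-single {M} {k} {replicate M (+ 0)} (dot-zero {M}) i _ y)
        (trans (DotPairing.pairing-single {M} {+ 0} ℤP.*-zeroˡ j (+ 1) (lookup y i)) (ℤP.*-identityˡ _))

formNorm : ∀ {k M} → Form k M → ℕ
formNorm = size (size ∣_∣)

linForm-bound : ∀ {k M} (K : ℕ) (f y : Form k M) →
                All (All (λ z → ∣ z ∣ ≤ K)) y → ∣ linForm f y ∣ ≤ formNorm f ℕ.* K
linForm-bound {k} {M} K = FormPairing.pairing-bound {M} {k} (size ∣_∣) (All (λ z → ∣ z ∣ ≤ K)) K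
  (DotPairing.pairing-bound {M} ∣_∣ (λ z → ∣ z ∣ ≤ K) K
     (λ a y y≤K → subst (_≤ ∣ a ∣ ℕ.* K) (sym (ℤP.abs-* a y)) (ℕP.*-monoʳ-≤ ∣ a ∣ y≤K)))

-- 2. Polynomials in n whose coefficients are affine forms

Affine : ℕ → ℕ → Set
Affine k M = Form k M × ℤ

⟦_⟧ : ∀ {k M} → Affine k M → Form k M → ℤ
⟦ f , γ ⟧ y = linForm f y + γ

-- Coefficient lists, lowest degree first.
AffPoly : ℕ → ℕ → Set
AffPoly k M = List (Affine k M)

horner : ∀ {m} → ℤ → Vec ℤ m → ℤ
horner t []       = + 0
horner t (d ∷ ds) = d + t * horner t ds

eval : ∀ {k M} → ℤ → Form k M → AffPoly k M → ℤ
eval t y []      = + 0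
eval t y (e ∷ P) = ⟦ e ⟧ y + t * eval t y P

_+ᴬ_ : ∀ {k M} → Affine k M → Affine k M → Affine k M
(f , α) +ᴬ (g , β) = f ⊕ g , α + β

_·ᴬ_ : ∀ {k M} → ℤ → Affine k M → Affine k M
c ·ᴬ (f , α) = c ⊛ f , c * α

zeroᴬ : ∀ {k M} → Affine k M
zeroᴬ = zeroForm , + 0

_+ᴾ_ : ∀ {k M} → AffPoly k M → AffPoly k M → AffPoly k M
[]      +ᴾ Q       = Q
(e ∷ P) +ᴾ []      = e ∷ P
(e ∷ P) +ᴾ (d ∷ Q) = (e +ᴬ d) ∷ (P +ᴾ Q)

_·ᴾ_ : ∀ {k M} → ℤ → AffPoly k M → AffPoly k M
c ·ᴾ P = L.map (c ·ᴬ_) P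

shift : ∀ {k M} → ℕ → AffPoly k M → AffPoly k M
shift l P = L.replicate l zeroᴬ L.++ P

Σᴾ : ∀ {k M} (m : ℕ) → (Fin m → AffPoly k M) → AffPoly k M
Σᴾ zero    g = []
Σᴾ (suc m) g = g zero +ᴾ Σᴾ m (λ i → g (suc i))

polyTimes : ∀ {k M} (d : ℕ) → (Fin (suc d) → ℤ) → AffPoly k M → AffPoly k M
polyTimes d c P = Σᴾ (suc d) (λ ℓ → shift (toℕ ℓ) (c ℓ ·ᴾ P))

oneᴾ : ∀ {k M} → AffPoly k M
oneᴾ = (zeroForm , + 1) ∷ []

digitRow : ∀ {k M} → Fin k → AffPoly k M
digitRow i = V.toList (tabulate (λ j → coordinate i j , + 0))

sumFin-cong : ∀ m {g h : Fin m → ℤ} → (∀ i → g i ≡ h i) → sumFin m g ≡ sumFin m h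
sumFin-cong zero    g≡h = refl
sumFin-cong (suc m) g≡h = cong₂ _+_ (g≡h zero) (sumFin-cong m (λ i → g≡h (suc i)))

sumFin-*ʳ : ∀ m (h : Fin m → ℤ) (v : ℤ) → sumFin m (λ i → h i * v) ≡ sumFin m h * v
sumFin-*ʳ zero    h v = sym (ℤP.*-zeroˡ v)
sumFin-*ʳ (suc m) h v =
  trans (cong (_+_ (h zero * v)) (sumFin-*ʳ m (λ i → h (suc i)) v))
        (sym (ℤP.*-distribʳ-+ v (h zero) (sumFin m (λ i → h (suc i)))))

module Evaluation {k M : ℕ} (t : ℤ) (y : Form k M) where

  ⟦⟧-zero : ⟦ zeroᴬ ⟧ y ≡ + 0
  ⟦⟧-zero = trans (ℤP.+-identityʳ _) (linForm-zero y)

  eval-+ᴾ : ∀ (P Q : AffPoly k M) → eval t y (P +ᴾ Q) ≡ eval t y P + eval t y Q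
  eval-+ᴾ []      Q       = sym (ℤP.+-identityˡ _)
  eval-+ᴾ (e ∷ P) []      = sym (ℤP.+-identityʳ _)
  eval-+ᴾ ((f , α) ∷ P) ((g , β) ∷ Q) =
    trans (cong₂ (λ u w → u + (α + β) + t * w) (linForm-⊕ f g y) (eval-+ᴾ P Q))
          (regroup (linForm f y) (linForm g y) α β t (eval t y P) (eval t y Q))
    where
    regroup : ∀ F G α β t P Q → F + G + (α + β) + t * (P + Q) ≡ F + α + t * P + (G + β + t * Q)
    regroup = solve-∀

  eval-·ᴾ : ∀ c (P : AffPoly k M) → eval t y (c ·ᴾ P) ≡ c * eval t y P
  eval-·ᴾ c []            = sym (ℤP.*-zeroʳ c)
  eval-·ᴾ c ((f , α) ∷ P) =
    trans (cong₂ (λ u w → u + c * α + t * w) (linForm-⊛ c f y) (eval-·ᴾ c P))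
          (factor c (linForm f y) α t (eval t y P))
    where
    factor : ∀ c F α t P → c * F + c * α + t * (c * P) ≡ c * (F + α + t * P)
    factor = solve-∀

  eval-shift : ∀ l (P : AffPoly k M) → eval t y (shift l P) ≡ t ^ l * eval t y P
  eval-shift zero    P = sym (ℤP.*-identityˡ _)
  eval-shift (suc l) P = begin
    ⟦ zeroᴬ ⟧ y + t * eval t y (shift l P) ≡⟨ cong₂ (λ u w → u + t * w) ⟦⟧-zero (eval-shift l P) ⟩
    + 0 + t * (t ^ l * eval t y P)         ≡⟨ ℤP.+-identityˡ _ ⟩
    t * (t ^ l * eval t y P)               ≡⟨ ℤP.*-assoc t (t ^ l) _ ⟨
    t ^ suc l * eval t y P                 ∎
    where open ≡-Reasoning

  eval-Σᴾ : ∀ m (g : Fin m → AffPoly k M) → eval t y (Σᴾ m g) ≡ sumFin m (λ i → eval t y (g i))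
  eval-Σᴾ zero    g = refl
  eval-Σᴾ (suc m) g =
    trans (eval-+ᴾ (g zero) _) (cong (_+_ (eval t y (g zero))) (eval-Σᴾ m (λ i → g (suc i))))

  eval-polyTimes : ∀ d c (P : AffPoly k M) → eval t y (polyTimes d c P) ≡ evalPoly d c t * eval t y P
  eval-polyTimes d c P = begin
    eval t y (polyTimes d c P)                              ≡⟨ eval-Σᴾ (suc d) (λ ℓ → shift (toℕ ℓ) (c ℓ ·ᴾ P)) ⟩
    sumFin (suc d) (λ ℓ → eval t y (shift (toℕ ℓ) (c ℓ ·ᴾ P))) ≡⟨ sumFin-cong (suc d) term ⟩
    sumFin (suc d) (λ ℓ → c ℓ * t ^ toℕ ℓ * eval t y P)     ≡⟨ sumFin-*ʳ (suc d) (λ ℓ → c ℓ * t ^ toℕ ℓ) (eval t y P) ⟩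
    evalPoly d c t * eval t y P                              ∎
    where
    open ≡-Reasoning
    swap : ∀ u c v → u * (c * v) ≡ c * u * v
    swap = solve-∀
    term : ∀ ℓ → eval t y (shift (toℕ ℓ) (c ℓ ·ᴾ P)) ≡ c ℓ * t ^ toℕ ℓ * eval t y P
    term ℓ = trans (eval-shift (toℕ ℓ) (c ℓ ·ᴾ P))
                   (trans (cong (t ^ toℕ ℓ *_) (eval-·ᴾ (c ℓ) P)) (swap _ (c ℓ) _))

  eval-oneᴾ : eval t y oneᴾ ≡ + 1
  eval-oneᴾ = cong₂ (λ u w → u + + 1 + w) (linForm-zero y) (ℤP.*-zeroʳ t)

  eval-tabulate : ∀ {m} (g : Fin m → Affine k M) →
                  eval t y (V.toList (tabulate g)) ≡ horner t (tabulate (λ j → ⟦ g j ⟧ y))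
  eval-tabulate {zero}  g = refl
  eval-tabulate {suc m} g = cong (λ w → ⟦ g zero ⟧ y + t * w) (eval-tabulate (λ j → g (suc j)))

  eval-digitRow : ∀ i → eval t y (digitRow i) ≡ horner t (lookup y i)
  eval-digitRow i = begin
    eval t y (digitRow i)                                        ≡⟨ eval-tabulate (λ j → coordinate i j , + 0) ⟩
    horner t (tabulate (λ j → linForm (coordinate i j) y + + 0)) ≡⟨ cong (horner t) (VP.tabulate-cong coord) ⟩
    horner t (tabulate (lookup (lookup y i)))                    ≡⟨ cong (horner t) (VP.tabulate∘lookup (lookup y i)) ⟩
    horner t (lookup y i)                                        ∎
    where
    open ≡-Reasoning
    coord : ∀ j → linForm (coordinate i j) y + + 0 ≡ lookup (lookup y i) j
    coord j = trans (ℤP.+-identityʳ _) (linForm-coordinate i j y)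

open Evaluation

dot-tabulate : ∀ {k} (g : Fin k → ℤ) (x : Vec ℤ k) → dot (tabulate g) x ≡ sumFin k (λ i → g i * lookup x i)
dot-tabulate g []       = refl
dot-tabulate g (x ∷ xs) = cong (_+_ (g zero * x)) (dot-tabulate (λ i → g (suc i)) xs)

-- 3. Coefficient bounds

affNorm : ∀ {k M} → Affine k M → ℕ
affNorm (f , γ) = formNorm f ℕ.+ ∣ γ ∣

polyNorm : ∀ {k M} → AffPoly k M → ℕ
polyNorm []      = 0
polyNorm (e ∷ P) = affNorm e ℕ.+ polyNorm P

affine-bound : ∀ {k M} (K : ℕ) → 1 ≤ K → (y : Form k M) → All (All (λ z → ∣ z ∣ ≤ K)) y →
               (e : Affine k M) → ∣ ⟦ e ⟧ y ∣ ≤ affNorm e ℕ.* K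
affine-bound K 1≤K y y≤K (f , γ) = begin
  ∣ linForm f y + γ ∣                       ≤⟨ ℤP.∣i+j∣≤∣i∣+∣j∣ (linForm f y) γ ⟩
  ∣ linForm f y ∣ ℕ.+ ∣ γ ∣                 ≤⟨ ℕP.+-mono-≤ (linForm-bound K f y y≤K) γ≤γK ⟩
  formNorm f ℕ.* K ℕ.+ ∣ γ ∣ ℕ.* K         ≡⟨ ℕP.*-distribʳ-+ K (formNorm f) ∣ γ ∣ ⟨
  affNorm (f , γ) ℕ.* K                     ∎
  where
  open ℕP.≤-Reasoning
  γ≤γK : ∣ γ ∣ ≤ ∣ γ ∣ ℕ.* K
  γ≤γK = subst (_≤ ∣ γ ∣ ℕ.* K) (ℕP.*-identityʳ ∣ γ ∣) (ℕP.*-monoʳ-≤ ∣ γ ∣ 1≤K)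

coefficients-bound : ∀ {k M} (K : ℕ) → 1 ≤ K → (y : Form k M) → All (All (λ z → ∣ z ∣ ≤ K)) y →
                     (P : AffPoly k M) → LA.All (λ e → ∣ ⟦ e ⟧ y ∣ ≤ polyNorm P ℕ.* K) P
coefficients-bound K 1≤K y y≤K []      = LA.[]
coefficients-bound K 1≤K y y≤K (e ∷ P) =
  ℕP.≤-trans (affine-bound K 1≤K y y≤K e) (ℕP.*-monoˡ-≤ K (ℕP.m≤m+n (affNorm e) (polyNorm P)))
  LA.∷ LA.map (λ h → ℕP.≤-trans h (ℕP.*-monoˡ-≤ K (ℕP.m≤n+m (polyNorm P) (affNorm e))))
              (coefficients-bound K 1≤K y y≤K P)

-- 4. The carry criterion

carryRange : ℕ → List ℤ
carryRange zero    = + 0 ∷ []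
carryRange (suc K) = + suc K ∷ -[1+ K ] ∷ carryRange K

∈-carryRange : ∀ K c → ∣ c ∣ ≤ K → c ∈ carryRange K
∈-carryRange zero    (+ zero)   _ = here refl
∈-carryRange (suc K) (+ m)      c≤K with ℕP.m≤n⇒m<n∨m≡n c≤K
... | inj₂ refl      = here refl
... | inj₁ (s≤s m≤K) = there (there (∈-carryRange K (+ m) m≤K))
∈-carryRange (suc K) -[1+ m ]   c≤K with ℕP.m≤n⇒m<n∨m≡n c≤K
... | inj₂ refl      = there (here refl)
... | inj₁ (s≤s m<K) = there (there (∈-carryRange K -[1+ m ] m<K))

-- If s + c = n·c' with |s| ≤ B·n, |c| ≤ B+1 and B < n, then again |c'| ≤ B+1:
-- carries stay in a range that does not depend on n.
carry-bound : ∀ n B (s c c' : ℤ) → suc B ≤ n → ∣ s ∣ ≤ B ℕ.* n → ∣ c ∣ ≤ suc B →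
              s + c ≡ + n * c' → ∣ c' ∣ ≤ suc B
carry-bound n B s c c' B<n s≤Bn c≤B eq =
  ℕP.*-cancelˡ-≤ n {{ℕ.>-nonZero (ℕP.≤-trans (s≤s z≤n) B<n)}} (begin
    n ℕ.* ∣ c' ∣           ≡⟨ ℤP.abs-* (+ n) c' ⟨
    ∣ + n * c' ∣           ≡⟨ cong ∣_∣ eq ⟨
    ∣ s + c ∣              ≤⟨ ℤP.∣i+j∣≤∣i∣+∣j∣ s c ⟩
    ∣ s ∣ ℕ.+ ∣ c ∣        ≤⟨ ℕP.+-mono-≤ s≤Bn (ℕP.≤-trans c≤B B<n) ⟩
    B ℕ.* n ℕ.+ n          ≡⟨ ℕP.+-comm (B ℕ.* n) n ⟩
    n ℕ.+ B ℕ.* n          ≡⟨ cong (n ℕ.+_) (ℕP.*-comm B n) ⟩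
    n ℕ.+ n ℕ.* B          ≡⟨ ℕP.*-suc n B ⟨
    n ℕ.* suc B            ∎)
  where open ℕP.≤-Reasoning

-- the carry equation  f(y) + γ + c = n·c'  as the constraint  c'·n + (−γ − c) = f(y)
carryConstraint : ∀ {k N} → ℤ → ℤ → Affine k (suc N) → Constraint k N
carryConstraint c c' (f , γ) = constraint c' (- γ + - c) f

-- the final carry must vanish:  0·n + c = 0
finalConstraint : ∀ {k N} → ℤ → Constraint k N
finalConstraint c = constraint (+ 0) c zeroForm

-- One system per carry sequence c = c₀, c₁, …, c_last with |cᵢ| ≤ K (i ≥ 1).
carrySystems : ∀ {k N} → ℕ → ℤ → AffPoly k (suc N) → List (List (Constraint k N))
carrySystems K c []      = (finalConstraint c ∷ []) ∷ []
carrySystems K c (e ∷ P) =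
  concatMap (λ c' → L.map (carryConstraint c c' e ∷_) (carrySystems K c' P)) (carryRange K)

T-does : ∀ {P : Set} (d : Dec P) → T (does d) ⇔ P
T-does (yes p) = mk⇔ (λ _ → p) _
T-does (no ¬p) = mk⇔ (λ ()) ¬p

any-all-cons : ∀ {A : Set} {P : A → Set} (x : A) (xss : List (List A)) →
               Any (LA.All P) (L.map (x ∷_) xss) ⇔ (P x × Any (LA.All P) xss)
any-all-cons {P = P} x xss = mk⇔ split join
  where
  split : Any (LA.All P) (L.map (x ∷_) xss) → P x × Any (LA.All P) xss
  split h = LA.head (proj₂ (LAny.satisfied h′)) , LAny.map LA.tail h′
    where
    h′ : Any (λ xs → LA.All P (x ∷ xs)) xss
    h′ = AnyP.map⁻ h
  join : P x × Any (LA.All P) xss → Any (LA.All P) (L.map (x ∷_) xss)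
  join (px , h) = AnyP.map⁺ (LAny.map (px LA.∷_) h)

module Carries {k N : ℕ} (n : ℕ) (y : Form k (suc N)) where

  t : ℤ
  t = + n

  Sat : Constraint k N → Set
  Sat C = T (satisfies t C y)

  carryConstraint-sat : ∀ c c' e → Sat (carryConstraint c c' e) ⇔ (⟦ e ⟧ y + c ≡ t * c')
  carryConstraint-sat c c' (f , γ) = mk⇔
    (λ s → let h = to (T-does (c' * t + (- γ + - c) ℤ.≟ linForm f y)) s in begin
       linForm f y + γ + c                 ≡⟨ cong (λ z → z + γ + c) h ⟨
       c' * t + (- γ + - c) + γ + c        ≡⟨ cancel c' t γ c ⟩
       t * c'                              ∎)
    (λ h → from (T-does (c' * t + (- γ + - c) ℤ.≟ linForm f y)) (begin
       c' * t + (- γ + - c)                ≡⟨ reorder c' t γ c ⟩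
       t * c' + (- γ + - c)                ≡⟨ cong (_+ (- γ + - c)) h ⟨
       linForm f y + γ + c + (- γ + - c)   ≡⟨ uncancel (linForm f y) γ c ⟩
       linForm f y                         ∎))
    where
    open ≡-Reasoning
    cancel : ∀ c' t γ c → c' * t + (- γ + - c) + γ + c ≡ t * c'
    cancel = solve-∀
    reorder : ∀ c' t γ c → c' * t + (- γ + - c) ≡ t * c' + (- γ + - c)
    reorder = solve-∀
    uncancel : ∀ F γ c → F + γ + c + (- γ + - c) ≡ F
    uncancel = solve-∀

  finalConstraint-sat : ∀ c → Sat (finalConstraint c) ⇔ (c ≡ + 0)
  finalConstraint-sat c = mk⇔
    (λ s → trans (sym (ℤP.+-identityˡ c)) (trans (to (T-does final?) s) (linForm-zero y)))
    (λ c≡0 → from (T-does final?) (trans (ℤP.+-identityˡ c) (trans c≡0 (sym (linForm-zero y)))))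
    where
    final? : Dec (+ 0 * t + c ≡ linForm zeroForm y)
    final? = + 0 * t + c ℤ.≟ linForm zeroForm y

  carries-sound : ∀ K c P → Any (LA.All Sat) (carrySystems K c P) → c + eval t y P ≡ + 0
  carries-sound K c [] (here (s LA.∷ LA.[])) =
    trans (ℤP.+-identityʳ c) (to (finalConstraint-sat c) s)
  carries-sound K c (e ∷ P) h
    with c' , h′ ← LAny.satisfied (AnyP.concatMap⁻ (λ c' → L.map (carryConstraint c c' e ∷_)
                                                               (carrySystems K c' P))
                                                    {xs = carryRange K} h)
    with s , rest ← to (any-all-cons _ _) h′ = begin
      c + (⟦ e ⟧ y + t * eval t y P)   ≡⟨ regroup c (⟦ e ⟧ y) t (eval t y P) ⟩
      ⟦ e ⟧ y + c + t * eval t y P     ≡⟨ cong (_+ t * eval t y P) (to (carryConstraint-sat c c' e) s) ⟩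
      t * c' + t * eval t y P          ≡⟨ ℤP.*-distribˡ-+ t c' _ ⟨
      t * (c' + eval t y P)            ≡⟨ cong (t *_) (carries-sound K c' P rest) ⟩
      t * + 0                          ≡⟨ ℤP.*-zeroʳ t ⟩
      + 0                              ∎
    where
    open ≡-Reasoning
    regroup : ∀ c s t E → c + (s + t * E) ≡ s + c + t * E
    regroup = solve-∀

  -- conversely, if the coefficients are small compared with n, the true carries
  -- c' = −(higher part) give a satisfied system
  carries-complete : ∀ B P → LA.All (λ e → ∣ ⟦ e ⟧ y ∣ ≤ B ℕ.* n) P → suc B ≤ n →
                     ∀ c → ∣ c ∣ ≤ suc B → c + eval t y P ≡ + 0 →
                     Any (LA.All Sat) (carrySystems (suc B) c P)
  carries-complete B [] LA.[] B<n c c≤B eq =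
    here (from (finalConstraint-sat c) (trans (sym (ℤP.+-identityʳ c)) eq) LA.∷ LA.[])
  carries-complete B (e ∷ P) (e≤Bn LA.∷ P≤Bn) B<n c c≤B eq =
    AnyP.concatMap⁺ (λ c' → L.map (carryConstraint c c' e ∷_) (carrySystems (suc B) c' P))
      (lose {P = λ c' → Any (LA.All Sat) (L.map (carryConstraint c c' e ∷_) (carrySystems (suc B) c' P))}
            (∈-carryRange (suc B) c' c'≤B)
            (from (any-all-cons _ _) (from (carryConstraint-sat c c' e) step , rest)))
    where
    open ≡-Reasoning
    E = eval t y P
    c' = - E
    step : ⟦ e ⟧ y + c ≡ t * c'
    step = begin
      ⟦ e ⟧ y + c                        ≡⟨ split c (⟦ e ⟧ y) t E ⟩
      c + (⟦ e ⟧ y + t * E) + t * - E    ≡⟨ cong (_+ t * - E) eq ⟩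
      + 0 + t * - E                      ≡⟨ ℤP.+-identityˡ _ ⟩
      t * c'                             ∎
      where
      split : ∀ c s t E → s + c ≡ c + (s + t * E) + t * - E
      split = solve-∀
    c'≤B : ∣ c' ∣ ≤ suc B
    c'≤B = carry-bound n B (⟦ e ⟧ y) c c' B<n e≤Bn c≤B step
    rest : Any (LA.All Sat) (carrySystems (suc B) c' P)
    rest = carries-complete B P P≤Bn B<n c' c'≤B (ℤP.+-inverseˡ E)

  inUnion-sat : ∀ systems → T (inUnion t systems y) ⇔ Any (LA.All Sat) systems
  inUnion-sat systems = mk⇔
    (λ h → LAny.map (LAP.all⁺ _ _) (AnyP.any⁻ _ systems h))
    (λ h → AnyP.any⁺ _ (LAny.map (LAP.all⁻ _) h))

-- 5. Base-n expansions

pos-^ : ∀ n m → (+ n) ^ m ≡ + (n ℕ.^ m)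
pos-^ n zero    = refl
pos-^ n (suc m) = trans (cong (+ n *_) (pos-^ n m)) (sym (ℤP.pos-* n (n ℕ.^ m)))

module BaseExpansion (n : ℕ) {{_ : NonZero n}} where

  value : ∀ {m} → Vec ℕ m → ℕ
  value []       = 0
  value (d ∷ ds) = d ℕ.+ n ℕ.* value ds

  digits : (m : ℕ) → ℕ → Vec ℕ m
  digits zero    x = []
  digits (suc m) x = x % n ∷ digits m (x / n)

  digits-< : ∀ m x → All (ℕ._< n) (digits m x)
  digits-< zero    x = []
  digits-< (suc m) x = m%n<n x n ∷ digits-< m (x / n)

  value-< : ∀ {m} (ds : Vec ℕ m) → All (ℕ._< n) ds → value ds ℕ.< n ℕ.^ m
  value-< []       []       = s≤s z≤n
  value-< {suc m} (d ∷ ds) (d<n ∷ ds<n) = begin-strict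
    d ℕ.+ n ℕ.* value ds        <⟨ ℕP.+-monoˡ-< (n ℕ.* value ds) d<n ⟩
    n ℕ.+ n ℕ.* value ds        ≡⟨ ℕP.*-suc n (value ds) ⟨
    n ℕ.* suc (value ds)        ≤⟨ ℕP.*-monoʳ-≤ n (value-< ds ds<n) ⟩
    n ℕ.* n ℕ.^ m               ∎
    where open ℕP.≤-Reasoning

  value-digits : ∀ m x → x ℕ.< n ℕ.^ m → value (digits m x) ≡ x
  value-digits zero    zero    _        = refl
  value-digits zero    (suc x) (s≤s ())
  value-digits (suc m) x       x<nᵐ⁺¹   = begin
    x % n ℕ.+ n ℕ.* value (digits m (x / n)) ≡⟨ cong (λ z → x % n ℕ.+ n ℕ.* z) (value-digits m (x / n) quotient<) ⟩
    x % n ℕ.+ n ℕ.* (x / n)                   ≡⟨ cong (x % n ℕ.+_) (ℕP.*-comm n (x / n)) ⟩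
    x % n ℕ.+ x / n ℕ.* n                     ≡⟨ m≡m%n+[m/n]*n x n ⟨
    x                                         ∎
    where
    open ≡-Reasoning
    quotient< : x / n ℕ.< n ℕ.^ m
    quotient< = m<n*o⇒m/o<n (subst (x ℕ.<_) (ℕP.*-comm n (n ℕ.^ m)) x<nᵐ⁺¹)

  digits-value : ∀ {m} (ds : Vec ℕ m) → All (ℕ._< n) ds → digits m (value ds) ≡ ds
  digits-value []       []           = refl
  digits-value (d ∷ ds) (d<n ∷ ds<n) = cong₂ _∷_ low (trans (cong (digits _) high) (digits-value ds ds<n))
    where
    v = value ds
    commuted : d ℕ.+ n ℕ.* v ≡ d ℕ.+ v ℕ.* n
    commuted = cong (d ℕ.+_) (ℕP.*-comm n v)
    low : (d ℕ.+ n ℕ.* v) % n ≡ d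
    low = trans (cong (_% n) commuted) (trans ([m+kn]%n≡m%n d v n) (m<n⇒m%n≡m d<n))
    no-overflow : d % n ℕ.+ (v ℕ.* n) % n ℕ.< n
    no-overflow = subst (ℕ._< n)
      (sym (trans (cong (d % n ℕ.+_) (m*n%n≡0 v n)) (ℕP.+-identityʳ (d % n)))) (m%n<n d n)
    high : (d ℕ.+ n ℕ.* v) / n ≡ v
    high = trans (cong (_/ n) commuted)
             (trans (+-distrib-/ d (v ℕ.* n) no-overflow) (cong₂ ℕ._+_ (m<n⇒m/n≡0 d<n) (m*n/n≡m v n)))

  Digit : ℤ → Set
  Digit z = (+ 0 ≤ℤ z) × (z < + n)

  InRange : ℕ → ℤ → Set
  InRange M x = (+ 0 ≤ℤ x) × (x < (+ n) ^ M)

  naturals : ∀ {m} → Vec ℕ m → Vec ℤ m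
  naturals = V.map (λ d → + d)

  toDigits : (M : ℕ) → ℤ → Vec ℤ M
  toDigits M x = naturals (digits M ∣ x ∣)

  horner-pos : ∀ {m} (ds : Vec ℕ m) → horner (+ n) (naturals ds) ≡ + value ds
  horner-pos []       = refl
  horner-pos (d ∷ ds) = begin
    + d + + n * horner (+ n) (naturals ds) ≡⟨ cong (λ z → + d + + n * z) (horner-pos ds) ⟩
    + d + + n * + value ds                 ≡⟨ cong (_+_ (+ d)) (ℤP.pos-* n (value ds)) ⟨
    + d + + (n ℕ.* value ds)               ≡⟨ ℤP.pos-+ d (n ℕ.* value ds) ⟨
    + value (d ∷ ds)                       ∎
    where open ≡-Reasoning

  natural-digits : ∀ {m} (ds : Vec ℤ m) → All Digit ds →
                   ∃ λ ns → (naturals ns ≡ ds) × All (ℕ._< n) ns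
  natural-digits []       []                       = [] , refl , []
  natural-digits (+ d ∷ ds) ((_ , +<+ d<n) ∷ ds-digits)
    with ns , refl , ns<n ← natural-digits ds ds-digits = d ∷ ns , refl , d<n ∷ ns<n

  toDigits-digits : ∀ M x → All Digit (toDigits M x)
  toDigits-digits M x = VAP.map⁺ (VA.map (λ d<n → +≤+ z≤n , +<+ d<n) (digits-< M ∣ x ∣))

  horner-toDigits : ∀ M x → InRange M x → horner (+ n) (toDigits M x) ≡ x
  horner-toDigits M (+ x) (_ , x<nᴹ) =
    trans (horner-pos (digits M x))
          (cong +_ (value-digits M x (ℤP.drop‿+<+ (subst (+ x <_) (pos-^ n M) x<nᴹ))))

  horner-inRange : ∀ M (ds : Vec ℤ M) → All Digit ds → InRange M (horner (+ n) ds)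
  horner-inRange M ds ds-digits with ns , refl , ns<n ← natural-digits ds ds-digits =
    subst (InRange M) (sym (horner-pos ns))
          (+≤+ z≤n , subst (+ value ns <_) (sym (pos-^ n M)) (+<+ (value-< ns ns<n)))

  toDigits-horner : ∀ M (ds : Vec ℤ M) → All Digit ds → toDigits M (horner (+ n) ds) ≡ ds
  toDigits-horner M ds ds-digits with ns , refl , ns<n ← natural-digits ds ds-digits =
    trans (cong (toDigits M) (horner-pos ns)) (cong naturals (digits-value ns ns<n))

  digit-small : ∀ z → Digit z → ∣ z ∣ ≤ n
  digit-small (+ z) (_ , +<+ z<n) = ℕP.<⇒≤ z<n

-- 6. Restricting a bijection to subsets

×-irrelevant : ∀ {A B : Set} → Irrelevant A → Irrelevant B → Irrelevant (A × B)
×-irrelevant irrA irrB (a , b) (a′ , b′) = cong₂ _,_ (irrA a a′) (irrB b b′)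

restrict-⤖ : ∀ {A B : Set} {P : A → Set} {Q : B → Set} →
             (∀ {a} → Irrelevant (P a)) → (∀ {b} → Irrelevant (Q b)) →
             (f : A → B) (g : B → A) →
             (∀ {a} → P a → Q (f a)) → (∀ {b} → Q b → P (g b)) →
             (∀ {a} → P a → g (f a) ≡ a) → (∀ {b} → Q b → f (g b) ≡ b) →
             Σ A P ⤖ Σ B Q
restrict-⤖ {P = P} {Q} irrP irrQ f g f-Q g-P gf≡id fg≡id =
  ↔⇒⤖ (mk↔ₛ′ forth back (λ { (b , q) → Σ-≡ irrQ (fg≡id q) })
                        (λ { (a , p) → Σ-≡ irrP (gf≡id p) }))
  where
  forth : Σ _ P → Σ _ Q
  forth (a , p) = f a , f-Q p
  back : Σ _ Q → Σ _ P
  back (b , q) = g b , g-P q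
  Σ-≡ : ∀ {C : Set} {R : C → Set} → (∀ {c} → Irrelevant (R c)) →
        ∀ {c c′} {r : R c} {r′ : R c′} → c ≡ c′ → (c , r) ≡ (c′ , r′)
  Σ-≡ irr {r = r} {r′} refl = cong (_ ,_) (irr r r′)

-- 7. The equation and its digit reformulation

module Equation (N : ℕ) {k : ℕ} (dᵢ : Fin k → ℕ) (a : (i : Fin k) → Fin (suc (dᵢ i)) → ℤ)
                (dm : ℕ) (mc : Fin (suc dm) → ℤ) where

  lhs : ℤ → Vec ℤ k → ℤ
  lhs t x = dot (tabulate (λ i → evalPoly (dᵢ i) (a i) t)) x

  rhs : ℤ → ℤ
  rhs t = evalPoly dm mc t

  lhsPoly : AffPoly k (suc N)
  lhsPoly = Σᴾ k (λ i → polyTimes (dᵢ i) (a i) (digitRow i))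

  rhsPoly : AffPoly k (suc N)
  rhsPoly = polyTimes dm mc oneᴾ

  residual : AffPoly k (suc N)
  residual = lhsPoly +ᴾ (-1ℤ ·ᴾ rhsPoly)

  eval-lhsPoly : ∀ t (y : Form k (suc N)) → eval t y lhsPoly ≡ lhs t (V.map (horner t) y)
  eval-lhsPoly t y = begin
    eval t y lhsPoly                                     ≡⟨ eval-Σᴾ t y k rows ⟩
    sumFin k (λ i → eval t y (rows i))                   ≡⟨ sumFin-cong k row ⟩
    sumFin k (λ i → coeff i * lookup (V.map (horner t) y) i) ≡⟨ dot-tabulate coeff (V.map (horner t) y) ⟨
    lhs t (V.map (horner t) y)                           ∎
    where
    open ≡-Reasoning
    coeff : Fin k → ℤ
    coeff i = evalPoly (dᵢ i) (a i) t
    rows : Fin k → AffPoly k (suc N)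
    rows i = polyTimes (dᵢ i) (a i) (digitRow i)
    row : ∀ i → eval t y (rows i) ≡ coeff i * lookup (V.map (horner t) y) i
    row i = trans (eval-polyTimes t y (dᵢ i) (a i) (digitRow i))
                  (cong (coeff i *_) (trans (eval-digitRow t y i) (sym (VP.lookup-map i (horner t) y))))

  eval-rhsPoly : ∀ t (y : Form k (suc N)) → eval t y rhsPoly ≡ rhs t
  eval-rhsPoly t y = begin
    eval t y (polyTimes dm mc oneᴾ) ≡⟨ eval-polyTimes t y dm mc oneᴾ ⟩
    rhs t * eval t y oneᴾ           ≡⟨ cong (rhs t *_) (eval-oneᴾ t y) ⟩
    rhs t * + 1                     ≡⟨ ℤP.*-identityʳ (rhs t) ⟩
    rhs t                           ∎
    where open ≡-Reasoning

  eval-residual : ∀ t (y : Form k (suc N)) → eval t y residual ≡ lhs t (V.map (horner t) y) -ℤ rhs t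
  eval-residual t y = begin
    eval t y residual                                      ≡⟨ eval-+ᴾ t y lhsPoly (-1ℤ ·ᴾ rhsPoly) ⟩
    eval t y lhsPoly + eval t y (-1ℤ ·ᴾ rhsPoly)           ≡⟨ cong (_+_ (eval t y lhsPoly)) (eval-·ᴾ t y -1ℤ rhsPoly) ⟩
    eval t y lhsPoly + -1ℤ * eval t y rhsPoly              ≡⟨ cong₂ (λ u v → u + -1ℤ * v) (eval-lhsPoly t y) (eval-rhsPoly t y) ⟩
    lhs t (V.map (horner t) y) + -1ℤ * rhs t               ≡⟨ cong (_+_ (lhs t (V.map (horner t) y))) (ℤP.-1*i≡-i (rhs t)) ⟩
    lhs t (V.map (horner t) y) -ℤ rhs t                    ∎
    where open ≡-Reasoning

  -- the constant B bounding the coefficients of the residual by B·n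
  bound : ℕ
  bound = polyNorm residual

  systems : List (List (Constraint k N))
  systems = carrySystems (suc bound) (+ 0) residual

  module _ (n : ℕ) {{_ : NonZero n}} (B<n : suc bound ≤ n) where
    open BaseExpansion n
    open Carries {k} {N} n

    criterion : (y : Form k (suc N)) → All (All Digit) y →
                (lhs (+ n) (V.map (horner (+ n)) y) ≡ rhs (+ n)) ⇔ T (inUnion (+ n) systems y)
    criterion y y-digits = mk⇔ solved⇒union union⇒solved
      where
      x = V.map (horner (+ n)) y
      vanishes : lhs (+ n) x ≡ rhs (+ n) → + 0 + eval (+ n) y residual ≡ + 0
      vanishes eq = trans (ℤP.+-identityˡ _) (trans (eval-residual (+ n) y) (ℤP.i≡j⇒i-j≡0 eq))
      small : LA.All (λ e → ∣ ⟦ e ⟧ y ∣ ≤ bound ℕ.* n) residual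
      small = coefficients-bound n (ℕP.≤-trans (s≤s z≤n) B<n) y
                (VA.map (λ {ds} → VA.map (λ {z} → digit-small z)) y-digits) residual
      solved⇒union : lhs (+ n) x ≡ rhs (+ n) → T (inUnion (+ n) systems y)
      solved⇒union eq = from (inUnion-sat y systems)
        (carries-complete y bound residual small B<n (+ 0) z≤n (vanishes eq))
      union⇒solved : T (inUnion (+ n) systems y) → lhs (+ n) x ≡ rhs (+ n)
      union⇒solved h = ℤP.i-j≡0⇒i≡j (lhs (+ n) x) (rhs (+ n))
        (trans (sym (eval-residual (+ n) y))
          (trans (sym (ℤP.+-identityˡ _))
            (carries-sound y (suc bound) (+ 0) residual (to (inUnion-sat y systems) h))))

    Solution : Vec ℤ k → Set
    Solution x = All (InRange (suc N)) x × lhs (+ n) x ≡ rhs (+ n)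

    DigitSolution : Form k (suc N) → Set
    DigitSolution y = All (All Digit) y × T (inUnion (+ n) systems y)

    expand : Vec ℤ k → Form k (suc N)
    expand = V.map (toDigits (suc N))

    contract : Form k (suc N) → Vec ℤ k
    contract = V.map (horner (+ n))

    contract∘expand : ∀ {m} (x : Vec ℤ m) → All (InRange (suc N)) x →
                      V.map (horner (+ n)) (V.map (toDigits (suc N)) x) ≡ x
    contract∘expand []       []       = refl
    contract∘expand (x ∷ xs) (r ∷ rs) = cong₂ _∷_ (horner-toDigits (suc N) x r) (contract∘expand xs rs)

    expand∘contract : ∀ {m} (y : Vec (Vec ℤ (suc N)) m) → All (All Digit) y →
                      V.map (toDigits (suc N)) (V.map (horner (+ n)) y) ≡ y
    expand∘contract []       []       = refl
    expand∘contract (y ∷ ys) (d ∷ ds) = cong₂ _∷_ (toDigits-horner (suc N) y d) (expand∘contract ys ds)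

    expand-digits : ∀ x → All (All Digit) (expand x)
    expand-digits x = VAP.map⁺ (VA.universal (toDigits-digits (suc N)) x)

    expand-solution : ∀ {x} → Solution x → DigitSolution (expand x)
    expand-solution {x} (x-range , eq) = expand-digits x ,
      to (criterion (expand x) (expand-digits x))
         (subst (λ v → lhs (+ n) v ≡ rhs (+ n)) (sym (contract∘expand x x-range)) eq)

    contract-solution : ∀ {y} → DigitSolution y → Solution (contract y)
    contract-solution {y} (y-digits , h) =
      VAP.map⁺ (VA.map (λ {ds} → horner-inRange (suc N) ds) y-digits) , from (criterion y y-digits) h

    digitBijection : Σ (Vec ℤ k) Solution ⤖ Σ (Form k (suc N)) DigitSolution
    digitBijection = restrict-⤖
      (×-irrelevant (VA.irrelevant (×-irrelevant ℤP.≤-irrelevant ℤP.<-irrelevant))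
                    (Decidable⇒UIP.≡-irrelevant ℤ._≟_))
      (×-irrelevant (VA.irrelevant (VA.irrelevant (×-irrelevant ℤP.≤-irrelevant ℤP.<-irrelevant)))
                    T-irrelevant)
      expand contract expand-solution contract-solution
      (λ {x} (x-range , _) → contract∘expand x x-range)
      (λ {y} (y-digits , _) → expand∘contract y y-digits)

  solutionBijection : ∀ n → suc bound ≤ n →
    (Σ (Vec ℤ k) λ x → All (λ xᵢ → (+ 0 ≤ℤ xᵢ) × (xᵢ < (+ n) ^ suc N)) x × lhs (+ n) x ≡ rhs (+ n))
    ⤖ (Σ (Form k (suc N)) λ y → All (All (λ yᵢⱼ → (+ 0 ≤ℤ yᵢⱼ) × (yᵢⱼ < + n))) y × T (inUnion (+ n) systems y))
  solutionBijection n@(suc _) B<n = digitBijection n B<n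

lemma3p2 : (N k : ℕ)
           (dᵢ : Fin k → ℕ) (a : (i : Fin k) → Fin (suc (dᵢ i)) → ℤ)
           (dm : ℕ) (mc : Fin (suc dm) → ℤ) → + 0 < mc (Data.Fin.fromℕ dm)
           → (d : ℕ) (b : Fin (suc d) → ℤ × ℤ)
           → (∀ (t : ℤ) → evalPoly dm mc t ≡ sumFin (suc d) (λ ℓ → evalLin (b ℓ) t * t ^ toℕ ℓ))
           → (∃ λ n₀ → ∀ n → n₀ ≤ n → ∀ ℓ → (+ 0 ≤ℤ evalLin (b ℓ) (+ n)) × (evalLin (b ℓ) (+ n) ≤ℤ (+ n) -ℤ (+ 1)))
           → b (Data.Fin.fromℕ d) ≢ (+ 0 , + 0)
           → (∀ i → dᵢ i ≤ d)
           → Σ (List (List (Constraint k N))) λ systems →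
             ∃ λ n₀ → ∀ n → n₀ ≤ n →
               (Σ (Vec ℤ k) λ x →
                   All (λ xi → (+ 0 ≤ℤ xi) × (xi < (+ n) ^ suc N)) x
                 × dot (tabulate (λ i → evalPoly (dᵢ i) (a i) (+ n))) x ≡ evalPoly dm mc (+ n))
               ⤖
               (Σ (Vec (Vec ℤ (suc N)) k) λ x →
                   All (All (λ xij → (+ 0 ≤ℤ xij) × (xij < + n))) x
                 × T (inUnion (+ n) systems x))
lemma3p2 N k dᵢ a dm mc _ d b _ _ _ _ = systems , suc bound , solutionBijection
  where open Equation N dᵢ a dm mc
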